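{- Let $G=(V,E,O,Pr)$ be a parity game and $J=(V,D,H)$ a safe justification for $G$. If $J$ has at least one unjustified node (equivalently, the parametrized parity game $G_{P_J}$ induced by $J$ is not $G$ itself), then there exist a node $v$ and a direct justification $dj$ of $v$ such that $\mathrm{Justify}(J,v,dj)$ is executable.
   Context: A parity game is $G=(V,E,O,Pr)$ with finite node set $V$, moves $E\subseteq V\times V$ (every node has an outgoing edge), owner $O:V\to\{0,1\}$ and priority $Pr:V\to\mathbb{N}$; $\bar\alpha=1-\alpha$. A play of $G$ is an infinite path along $E$, won by player $(n\bmod 2)$ where $n$ is the highest priority occurring infinitely often. A direct justification for $\alpha$ to win $v$: one outgoing edge of $v$ if $O(v)=\alpha$, all outgoing edges of $v$ if $O(v)=\bar\alpha$; it wins $v$ for $\alpha$ under $H:V\to\{0,1\}$ if $H(w)=\alpha$ for all its edges $(v,w)$. A justification is $J=(V,D,H)$ with $D\subseteq E$, $H:V\to\{0,1\}$; $v$ is justified if it has outgoing edges in $D$, unjustified otherwise. The induced parametrized parity game $G_{P_J}$ is $G$ with the unjustified nodes as parameters (a play halts on reaching one, won by its $H$-value); it equals $G$ iff all nodes are justified. $J$ is weakly winning if each justified node's set of outgoing $D$-edges is a direct justification winning it for $H(v)$ under $H$; $J$ is winning if moreover every infinite path $v_1,v_2,\dots$ in $(V,D)$ is won by $H(v_1)$. The justification level $jl_J(v)$ is the minimum priority of unjustified nodes reachable from $v$ in $(V,D)$ (including $v$ itself), or $+\infty$ if there are none; for a direct justification $dj=\{(v,w_1),\dots,(v,w_k)\}$,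 $jl_J(dj)=\min_i jl_J(w_i)$. The default hypothesis is $H_d(v)=Pr(v)\bmod 2$. $J$ is safe if (i) $J$ is winning, (ii) $H(v)=H_d(v)$ for all unjustified $v$, and (iii) $jl_J(v)\ge Pr(v)$ for all $v$. $\mathrm{Justify}(J,v,dj)$ is executable if: (1) $J$ is safe and there is a player $\alpha$ such that $dj$ is a direct justification that wins $v$ for $\alpha$ under $H$; (2) if $v$ is unjustified in $J$ then $jl_J(dj)\ge jl_J(v)$, and if $v$ is justified then $jl_J(dj)>jl_J(v)$. -}

module Defs where

open import Data.Nat using (ℕ; zero; suc; _≤_; _<_)
open import Data.Fin using (Fin)
open import Data.Bool using (Bool; true; false)
open import Data.Maybe using (Maybe; just; nothing)
open import Data.Product using (Σ; ∃; ∃-syntax; _×_; _,_)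
open import Data.Sum using (_⊎_)
open import Relation.Nullary using (¬_)
open import Relation.Binary.PropositionalEquality using (_≡_; _≢_)
open import Relation.Binary.Construct.Closure.ReflexiveTransitive using (Star)

data Player : Set where
  P0 P1 : Player

parity : ℕ → Player
parity zero = P0
parity (suc zero) = P1
parity (suc (suc k)) = parity k

record ParityGame : Set where
  field
    n     : ℕ
    E     : Fin n → Fin n → Bool
    total : ∀ v → ∃[ w ] (E v w ≡ true)
    O     : Fin n → Player
    Pr    : Fin n → ℕ

module _ (G : ParityGame) where
  open ParityGame G

  IsPath : (Fin n → Fin n → Bool) → (ℕ → Fin n) → Set
  IsPath R p = ∀ i → R (p i) (p (suc i)) ≡ true

  WinsPlay : Player → (ℕ → Fin n) → Set
  WinsPlay α p = ∃[ m ] (parity m ≡ α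
                        × (∀ i → ∃[ j ] (i ≤ j × Pr (p j) ≡ m))
                        × ∃[ i ] (∀ j → i ≤ j → Pr (p j) ≤ m))

  -- A direct justification of v is given as a set of targets dj : Fin n → Bool
  -- (the edges (v,w) with dj w ≡ true).
  IsDirectJust : Fin n → Player → (Fin n → Bool) → Set
  IsDirectJust v α dj =
    (O v ≡ α → ∃[ w ] (E v w ≡ true × (∀ u → dj u ≡ true → u ≡ w) × dj w ≡ true))
    × (O v ≢ α → ∀ u → dj u ≡ E v u)

  WinsDJ : (Fin n → Player) → Fin n → Player → (Fin n → Bool) → Set
  WinsDJ H v α dj = IsDirectJust v α dj × (∀ w → dj w ≡ true → H w ≡ α)

  record Justification : Set where
    field
      D   : Fin n → Fin n → Bool
      D⊆E : ∀ v w → D v w ≡ true → E v w ≡ true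
      H   : Fin n → Player

  module _ (J : Justification) where
    open Justification J

    Justified : Fin n → Set
    Justified v = ∃[ w ] (D v w ≡ true)

    Unjustified : Fin n → Set
    Unjustified v = ¬ Justified v

    Reach : Fin n → Fin n → Set
    Reach = Star (λ a b → D a b ≡ true)

    WeaklyWinning : Set
    WeaklyWinning = ∀ v → Justified v → WinsDJ H v (H v) (D v)

    Winning : Set
    Winning = WeaklyWinning × (∀ p → IsPath D p → WinsPlay (H (p 0)) p)

    -- ℕ∞ = Maybe ℕ, nothing = +∞
    -- IsJL v k : k is the justification level of v, i.e. the minimum priority
    -- of unjustified nodes reachable from v in (V,D) (+∞ if none)
    IsJLSet : (Fin n → Bool) → Maybe ℕ → Set
    IsJLSet S nothing = ∀ w u → S w ≡ true → Reach w u → Justified u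
    IsJLSet S (just m) =
      ∃[ w ] ∃[ u ] (S w ≡ true × Reach w u × Unjustified u × Pr u ≡ m)
      × (∀ w u → S w ≡ true → Reach w u → Unjustified u → m ≤ Pr u)

    IsJL : Fin n → Maybe ℕ → Set
    IsJL v nothing = ∀ u → Reach v u → Justified u
    IsJL v (just m) =
      ∃[ u ] (Reach v u × Unjustified u × Pr u ≡ m)
      × (∀ u → Reach v u → Unjustified u → m ≤ Pr u)

    -- jl_J(dj) = min over targets w of jl_J(w)
    IsJLdj : (Fin n → Bool) → Maybe ℕ → Set
    IsJLdj = IsJLSet

    Safe : Set
    Safe = Winning
         × (∀ v → Unjustified v → H v ≡ parity (Pr v))
         -- jl_J(v) ≥ Pr(v), unfolded: every reachable unjustified u has Pr u ≥ Pr v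
         × (∀ v u → Reach v u → Unjustified u → Pr v ≤ Pr u)

_≤∞_ : Maybe ℕ → Maybe ℕ → Set
_ ≤∞ nothing = Data.Unit.⊤ where import Data.Unit
nothing ≤∞ just _ = Data.Empty.⊥ where import Data.Empty
just a ≤∞ just b = a ≤ b

_<∞_ : Maybe ℕ → Maybe ℕ → Set
just a <∞ nothing = Data.Unit.⊤ where import Data.Unit
nothing <∞ _ = Data.Empty.⊥ where import Data.Empty
just a <∞ just b = a < b

module _ (G : ParityGame) where
  open ParityGame G

  Executable : Justification G → Fin n → (Fin n → Bool) → Set
  Executable J v dj =
    Safe G J
    × ∃[ α ] WinsDJ G (Justification.H J) v α dj
    × ∃[ k ] ∃[ kdj ] (IsJL G J v k × IsJLdj G J dj kdj
        × (Unjustified G J v → k ≤∞ kdj)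
        × (Justified G J v → k <∞ kdj))

-- Let v be an unjustified node of least priority among all unjustified nodes.
-- Then jl(v) = Pr(v): v reaches itself, and by safety every unjustified node
-- reachable from v has priority at least Pr(v). Every node has a direct
-- justification winning it for some player under H (a successor with
-- H = O(v) if there is one, otherwise all successors, which then win for the
-- opponent), and any such dj satisfies jl(dj) ≥ Pr(v) by the choice of v.
-- The only real work is that jl(dj) exists at all, i.e. that reachability in
-- the finite graph (V, D) is decidable: the reachable set is grown one
-- frontier node at a time, which terminates because subsets of V are
-- well-founded under ⊃.
module Submission where

open import Defs
open import Data.Bool using (Bool; true)
open import Data.Bool.Properties using () renaming (_≟_ to _≟ᴮ_)
open import Data.Fin using (Fin; zero; suc; _≟_)
open import Data.Fin.Properties using (any?)
open import Data.Fin.Subset using (Subset; _∈_; _∉_; _⊃_; _∪_; ⁅_⁆; ⊥)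
open import Data.Fin.Subset.Properties using (_∈?_; ∉⊥; x∈⁅x⁆; x∈⁅y⁆⇒x≡y; p⊆p∪q; x∈p∪q⁺; x∈p∪q⁻)
open import Data.Fin.Subset.Induction using (⊃-wellFounded; Acc; acc)
open import Data.Maybe using (just; nothing)
open import Data.Nat using (ℕ; _≤_)
open import Data.Nat.Properties using (≤-refl; ≤-trans; ≤-total)
open import Data.Product using (∃; ∃-syntax; _×_; _,_)
open import Data.Sum using (_⊎_; inj₁; inj₂)
open import Data.Unit using (tt)
open import Level using (0ℓ)
open import Relation.Binary.Construct.Closure.ReflexiveTransitive using (Star; ε; _◅_; _◅◅_)
open import Relation.Binary.Definitions using (DecidableEquality) renaming (Decidable to Decidable₂)
open import Relation.Binary.PropositionalEquality using (_≡_; _≢_; refl; sym; subst)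
open import Relation.Nullary using (Dec; yes; no; ¬_; does; contradiction)
open import Relation.Nullary.Decidable using (¬?; _×-dec_; _⊎-dec_; map′; decidable-stable; dec-true)
open import Relation.Unary using (Pred; Decidable)

opponent : Player → Player
opponent P0 = P1
opponent P1 = P0

_≟ᴾ_ : DecidableEquality Player
P0 ≟ᴾ P0 = yes refl
P0 ≟ᴾ P1 = no λ ()
P1 ≟ᴾ P0 = no λ ()
P1 ≟ᴾ P1 = yes refl

≢-opponent : ∀ α → α ≢ opponent α
≢-opponent P0 ()
≢-opponent P1 ()

≢⇒≡opponent : ∀ {α β} → α ≢ β → α ≡ opponent β
≢⇒≡opponent {P0} {P0} α≢β = contradiction refl α≢β
≢⇒≡opponent {P0} {P1} _   = refl
≢⇒≡opponent {P1} {P0} _   = refl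
≢⇒≡opponent {P1} {P1} α≢β = contradiction refl α≢β

empty⊎minimiser : ∀ {m} {P : Pred (Fin m) 0ℓ} → Decidable P → (f : Fin m → ℕ)
  → (∀ u → ¬ P u) ⊎ ∃[ u ] (P u × (∀ u′ → P u′ → f u ≤ f u′))
empty⊎minimiser {ℕ.zero} P? f = inj₁ λ ()
empty⊎minimiser {ℕ.suc m} P? f
  with P? zero | empty⊎minimiser (λ i → P? (suc i)) (λ i → f (suc i))
... | no ¬p0 | inj₁ empty = inj₁ λ { zero → ¬p0 ; (suc i) → empty i }
... | yes p0 | inj₁ empty = inj₂ (zero , p0 , λ { zero _ → ≤-refl ; (suc i) pi → contradiction pi (empty i) })
... | no ¬p0 | inj₂ (u , pu , min) = inj₂ (suc u , pu , λ { zero p0 → contradiction p0 ¬p0 ; (suc i) → min i })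
... | yes p0 | inj₂ (u , pu , min) with ≤-total (f zero) (f (suc u))
...   | inj₁ f0≤fu = inj₂ (zero , p0 , λ { zero _ → ≤-refl ; (suc i) pi → ≤-trans f0≤fu (min i pi) })
...   | inj₂ fu≤f0 = inj₂ (suc u , pu , λ { zero _ → fu≤f0 ; (suc i) → min i })

module Reachability {m : ℕ} {_⟶_ : Fin m → Fin m → Set} (_⟶?_ : Decidable₂ _⟶_)
                    {Source : Pred (Fin m) 0ℓ} (source? : Decidable Source) where

  ReachableFrom : Pred (Fin m) 0ℓ
  ReachableFrom u = ∃[ w ] (Source w × Star _⟶_ w u)

  Sound : Subset m → Set
  Sound C = ∀ {u} → u ∈ C → ReachableFrom u

  Frontier : Subset m → Pred (Fin m) 0ℓ
  Frontier C x = x ∉ C × (Source x ⊎ ∃[ y ] (y ∈ C × y ⟶ x))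

  frontier? : ∀ C → Dec (∃ (Frontier C))
  frontier? C = any? λ x → ¬? (x ∈? C) ×-dec (source? x ⊎-dec any? λ y → (y ∈? C) ×-dec (y ⟶? x))

  record Closure : Set where
    field
      carrier : Subset m
      sound   : Sound carrier
      sources : ∀ {x} → Source x → x ∈ carrier
      closed  : ∀ {x y} → x ∈ carrier → x ⟶ y → y ∈ carrier

  sound-∪⁅frontier⁆ : ∀ {C x} → Sound C → Frontier C x → Sound (C ∪ ⁅ x ⁆)
  sound-∪⁅frontier⁆ {C} {x} soundC (_ , new) u∈C∪x with x∈p∪q⁻ C ⁅ x ⁆ u∈C∪x
  ... | inj₁ u∈C = soundC u∈C
  ... | inj₂ u∈x with x∈⁅y⁆⇒x≡y x u∈x | new
  ...   | refl | inj₁ src = x , src , ε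
  ...   | refl | inj₂ (y , y∈C , y⟶x) with soundC y∈C
  ...     | w , src , w↝y = w , src , w↝y ◅◅ (y⟶x ◅ ε)

  grow : ∀ C → Sound C → Acc _⊃_ C → Closure
  grow C soundC (acc rec) with frontier? C
  ... | yes (x , frontier@(x∉C , _)) =
    grow (C ∪ ⁅ x ⁆) (sound-∪⁅frontier⁆ soundC frontier)
         (rec (p⊆p∪q ⁅ x ⁆ , x , x∈p∪q⁺ (inj₂ (x∈⁅x⁆ x)) , x∉C))
  ... | no noFrontier = record
    { carrier = C
    ; sound   = soundC
    ; sources = λ {x} src → decidable-stable (x ∈? C) λ x∉C → noFrontier (x , x∉C , inj₁ src)
    ; closed  = λ {x} {y} x∈C x⟶y →
        decidable-stable (y ∈? C) λ y∉C → noFrontier (y , y∉C , inj₂ (x , x∈C , x⟶y))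
    }

  closure : Closure
  closure = grow ⊥ (λ u∈⊥ → contradiction u∈⊥ ∉⊥) (⊃-wellFounded ⊥)

  open Closure closure

  closed-Star : ∀ {x y} → x ∈ carrier → Star _⟶_ x y → y ∈ carrier
  closed-Star x∈C ε         = x∈C
  closed-Star x∈C (e ◅ x↝y) = closed-Star (closed x∈C e) x↝y

  reachable? : Decidable ReachableFrom
  reachable? u = map′ sound (λ (_ , src , w↝u) → closed-Star (sources src) w↝u) (u ∈? carrier)

module _ (G : ParityGame) where
  open ParityGame G

  winningDirectJust : (H : Fin n → Player) (v : Fin n) → ∃[ α ] ∃[ dj ] WinsDJ G H v α dj
  winningDirectJust H v with any? (λ w → (E v w ≟ᴮ true) ×-dec (H w ≟ᴾ O v))
  ... | yes (w , v⟶w , Hw≡Ov) =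
    O v , singleton
        , ((λ _ → w , v⟶w , onlyW , dec-true (w ≟ w) refl) , λ Ov≢Ov → contradiction refl Ov≢Ov)
        , λ u u∈dj → subst (λ u → H u ≡ O v) (sym (onlyW u u∈dj)) Hw≡Ov
    where
    singleton : Fin n → Bool
    singleton u = does (u ≟ w)
    onlyW : ∀ u → singleton u ≡ true → u ≡ w
    onlyW u _ with u ≟ w
    ... | yes u≡w = u≡w
  ... | no noneForOwner =
    opponent (O v) , E v , ((λ Ov≡opp → contradiction Ov≡opp (≢-opponent (O v))) , λ _ _ → refl)
      , λ w v⟶w → ≢⇒≡opponent λ Hw≡Ov → noneForOwner (w , v⟶w , Hw≡Ov)

  module _ (J : Justification G) where
    open Justification J

    justified? : Decidable (Justified G J)
    justified? v = any? λ w → D v w ≟ᴮ true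

    justificationLevel : (S : Fin n → Bool) → ∃[ k ] IsJLSet G J S k
    justificationLevel S
      with empty⊎minimiser (λ u → reachable? u ×-dec ¬? (justified? u)) Pr
      where open Reachability (λ a b → D a b ≟ᴮ true) (λ w → S w ≟ᴮ true)
    ... | inj₁ none = nothing , λ w u w∈S w↝u →
      decidable-stable (justified? u) λ unj → none u ((w , w∈S , w↝u) , unj)
    ... | inj₂ (u , ((w , w∈S , w↝u) , unj) , min) =
      just (Pr u) , w , u , (w∈S , w↝u , unj , refl)
                  , λ w′ u′ w′∈S w′↝u′ unj′ → min u′ ((w′ , w′∈S , w′↝u′) , unj′)

    justificationLevel-unjustified : Safe G J → ∀ {v} → Unjustified G J v → IsJL G J v (just (Pr v))
    justificationLevel-unjustified (_ , _ , jl≥Pr) {v} unj =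
      v , (ε , unj , refl) , jl≥Pr v

    ≤∞-justificationLevel : ∀ {m S k} → (∀ u → Unjustified G J u → m ≤ Pr u)
      → IsJLSet G J S k → just m ≤∞ k
    ≤∞-justificationLevel {k = nothing} _     _ = tt
    ≤∞-justificationLevel {k = just _}  lower (_ , u , (_ , _ , unj , refl) , _) = lower u unj

lemma2 : (G : ParityGame) (J : Justification G)
    → Safe G J
    → ∃[ u ] Unjustified G J u
    → ∃[ v ] ∃[ dj ] Executable G J v dj
lemma2 G J safe (u , unj-u)
  with empty⊎minimiser (λ x → ¬? (justified? G J x)) (ParityGame.Pr G)
... | inj₁ none = contradiction unj-u (none u)
... | inj₂ (v , unj-v , minimal)
  with winningDirectJust G (Justification.H J) v
... | α , dj , wins
  with justificationLevel G J dj
... | k , jl-dj =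
  v , dj , safe , α , wins , just (ParityGame.Pr G v) , k
    , justificationLevel-unjustified G J safe unj-v , jl-dj
    , (λ _ → ≤∞-justificationLevel G J minimal jl-dj)
    , (λ jus → contradiction jus unj-v)
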